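{- Let $\mathfrak U$ and $\mathfrak V$ be generalized models (in the narrow sense) in the same signature with universes $\beta X$ and $\beta Y$, both with interpretations pseudo-principal on functional symbols. Let $\mathfrak A$ and $\mathfrak B$ be ordinary models with universes $X$ and $Y$ such that $\widetilde{\mathfrak A}=e(\mathfrak U)$ and $\widetilde{\mathfrak B}=e(\mathfrak V)$ (so that $\mathfrak A^*=E(\mathfrak U)$ and $\mathfrak B^*=E(\mathfrak V)$), and let $h:X\to Y$. The following are equivalent: (i) $h$ is a homomorphism of $\mathfrak A$ into $\mathfrak B$; (ii) $\tilde h$ is a homomorphism of $\mathfrak U$ into $\mathfrak V$; (iii) $\tilde h$ is a homomorphism of $\widetilde{\mathfrak A}$ into $\widetilde{\mathfrak B}$; (iv) $\tilde h$ is a homomorphism of $\mathfrak A^*$ into $\mathfrak B^*$.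
   Context: $\beta Z$ is the set of ultrafilters on $Z$, $Z\subseteq\beta Z$ via principal ultrafilters, standard compact Hausdorff topology; $(\forall^{\mathfrak u}z)\varphi$ means $\{z:\varphi\}\in\mathfrak u$. For $h:X\to Y$, $\tilde h:\beta X\to\beta Y$ is $\tilde h(\mathfrak u)=\{A\subseteq Y:h^{ -1}(A)\in\mathfrak u\}$ (the continuous extension). For $f:Z^n\to Z$, $\tilde f(\mathfrak u_1,\dots,\mathfrak u_n)=\{A:(\forall^{\mathfrak u_1}z_1)\cdots(\forall^{\mathfrak u_n}z_n)f(z_1,\dots,z_n)\in A\}$; for $Q\subseteq Z^n$, $\tilde Q=\{(\mathfrak u_i):(\forall^{\mathfrak u_1}z_1)\cdots(\forall^{\mathfrak u_n}z_n)(z_1,\dots,z_n)\in Q\}$ and $Q^*=\{(\mathfrak u_i):\forall A_i\in\mathfrak u_i\ Q\cap(A_1\times\dots\times A_n)\ne\emptyset\}$; for an ordinary model $\mathfrak A=(Z,F,\dots,R,\dots)$, $\widetilde{\mathfrak A}=(\beta Z,\tilde F,\dots,\tilde R,\dots)$ and $\mathfrak A^*=(\beta Z,\tilde F,\dots,R^*,\dots)$. A homomorphism of ordinary models is a map commuting with all operations and sending tuples in each relation to tuples in the corresponding relation. A generalized model in the narrow sense with universe $\beta Z$ is an interpretation $\imath$ with $\imath(F)\in\beta(Z^{Z^n})$, $\imath(R)\in\beta\,\mathcal P(Z^n)$ for $n$-ary symbols; it is pseudo-principal on functional symbols if for every $F$ and all $a_1,\dots,a_n\in Z$, $\{A:(\forall^{\imath(F)}f)f(a_1,\dots,a_n)\in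 A\}$ is principal. $e,E$: $e=E$ on $\beta(Z^{Z^n})$ is the unique continuous extension of $f\mapsto\tilde f$ into the compact Hausdorff space of $n$-ary operations on $\beta Z$ right continuous w.r.t. $Z$ (continuous in the $i$-th argument when the first $i-1$ arguments are in $Z$), topologized by pointwise convergence on $Z^n$; $e$ on $\beta\,\mathcal P(Z^n)$ is the same construction via characteristic functions into discrete $\{0,1\}$; $E(\mathfrak r)=\{(\pi_1(\mathfrak q),\dots,\pi_n(\mathfrak q)):\mathfrak q\in e_1(\mathfrak r)\}$ with $e_1(\mathfrak r)\subseteq\beta(Z^n)$ the $e$-construction applied to $\mathfrak r$ as an ultrafilter over unary relations on $Z^n$, $\pi_i(\mathfrak q)=\{A:\{x:x_i\in A\}\in\mathfrak q\}$. $e(\mathfrak U)$, $E(\mathfrak U)$ are the ordinary models on $\beta Z$ obtained by applying $e$, resp. $E$, to each interpreting ultrafilter. A map $g:\beta X\to\beta Y$ is a homomorphism of generalized models $\mathfrak U$ into $\mathfrak V$ iff it is a homomorphism of $e(\mathfrak U)$ into $e(\mathfrak V)$. -}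

module Defs where

open import Level using (Level; _⊔_; Lift; lift) renaming (suc to lsuc; zero to lzero)
open import Data.Nat using (ℕ; zero; suc)
open import Data.Fin using (Fin)
open import Data.Vec using (Vec; []; _∷_; map; lookup)
open import Data.Product using (_×_; _,_; Σ; proj₁; proj₂)
open import Data.Sum using (_⊎_; inj₁; inj₂)
open import Data.Unit using (⊤; tt)
open import Data.Empty using (⊥; ⊥-elim)
open import Relation.Nullary using (¬_)
open import Relation.Binary.PropositionalEquality using (_≡_)
open import Function.Bundles using (_⇔_)

ℓ₁ : Level
ℓ₁ = lsuc lzero

ℓ₂ : Level
ℓ₂ = lsuc ℓ₁

-- Subsets of Z are predicates Z → Set₁ (this contains all
-- Set₀-valued predicates via Lift).  An ultrafilter is a proper, upward
-- closed, ∩-closed, prime family of subsets (prime: A ∪ B ∈ u ⇒ A ∈ u or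
-- B ∈ u), the standard classically-equivalent definition of ultrafilter.

record Ultra {a} (Z : Set a) : Set (a ⊔ ℓ₂) where
  field
    mem    : (Z → Set ℓ₁) → Set ℓ₁
    mono   : ∀ {A B : Z → Set ℓ₁} → (∀ z → A z → B z) → mem A → mem B
    full   : mem (λ _ → Lift ℓ₁ ⊤)
    inter  : ∀ {A B : Z → Set ℓ₁} → mem A → mem B → mem (λ z → A z × B z)
    proper : ¬ mem (λ _ → Lift ℓ₁ ⊥)
    prime  : ∀ {A B : Z → Set ℓ₁} → mem (λ z → A z ⊎ B z) → mem A ⊎ mem B

open Ultra public

_≈ᵘ_ : ∀ {a} {Z : Set a} → Ultra Z → Ultra Z → Set (a ⊔ ℓ₂)
u ≈ᵘ v = ∀ A → mem u A ⇔ mem v A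

principal : ∀ {a} {Z : Set a} → Z → Ultra Z
principal z = record
  { mem = λ A → A z ; mono = λ f p → f z p ; full = lift tt
  ; inter = λ p q → p , q ; proper = λ { (lift ()) } ; prime = λ p → p }

-- continuous extension h̃ : βX → βY  (push-forward)
tilde : ∀ {a b} {X : Set a} {Y : Set b} → (X → Y) → Ultra X → Ultra Y
tilde h u = record
  { mem = λ A → mem u (λ x → A (h x))
  ; mono = λ f → mono u (λ x → f (h x))
  ; full = full u ; inter = inter u ; proper = proper u ; prime = prime u }

Q : ∀ {a} {X : Set a} (n : ℕ) → Vec (Ultra X) n → (Vec X n → Set ℓ₁) → Set ℓ₁
Q zero    []       φ = φ []
Q (suc n) (u ∷ us) φ = mem u (λ z → Q n us (λ zs → φ (z ∷ zs)))

Q-mono : ∀ {a} {X : Set a} n (us : Vec (Ultra X) n) {φ ψ : Vec X n → Set ℓ₁} →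
         (∀ zs → φ zs → ψ zs) → Q n us φ → Q n us ψ
Q-mono zero [] f q = f [] q
Q-mono (suc n) (u ∷ us) f q = mono u (λ z → Q-mono n us (λ zs → f (z ∷ zs))) q

Q-full : ∀ {a} {X : Set a} n (us : Vec (Ultra X) n) {φ : Vec X n → Set ℓ₁} →
         (∀ zs → φ zs) → Q n us φ
Q-full zero [] f = f []
Q-full (suc n) (u ∷ us) f =
  mono u (λ z _ → Q-full n us (λ zs → f (z ∷ zs))) (full u)

Q-inter : ∀ {a} {X : Set a} n (us : Vec (Ultra X) n) {φ ψ : Vec X n → Set ℓ₁} →
          Q n us φ → Q n us ψ → Q n us (λ zs → φ zs × ψ zs)
Q-inter zero [] p q = p , q
Q-inter (suc n) (u ∷ us) p q =
  mono u (λ z pq → Q-inter n us (proj₁ pq) (proj₂ pq)) (inter u p q)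

Q-proper : ∀ {a} {X : Set a} n (us : Vec (Ultra X) n) {φ : Vec X n → Set ℓ₁} →
           (∀ zs → ¬ φ zs) → ¬ Q n us φ
Q-proper zero [] f q = f [] q
Q-proper (suc n) (u ∷ us) f q =
  proper u (mono u (λ z qz → ⊥-elim (Q-proper n us (λ zs → f (z ∷ zs)) qz)) q)

Q-prime : ∀ {a} {X : Set a} n (us : Vec (Ultra X) n) {φ ψ : Vec X n → Set ℓ₁} →
          Q n us (λ zs → φ zs ⊎ ψ zs) → Q n us φ ⊎ Q n us ψ
Q-prime zero [] q = q
Q-prime (suc n) (u ∷ us) q = prime u (mono u (λ z → Q-prime n us) q)

bind : ∀ {a b} {X : Set a} {Y : Set b} (n : ℕ) → Vec (Ultra X) n →
       (Vec X n → Ultra Y) → Ultra Y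
bind n us G = record
  { mem = λ A → Q n us (λ zs → mem (G zs) A)
  ; mono = λ f → Q-mono n us (λ zs → mono (G zs) f)
  ; full = Q-full n us (λ zs → full (G zs))
  ; inter = λ p q → Q-mono n us (λ zs pq → inter (G zs) (proj₁ pq) (proj₂ pq))
                      (Q-inter n us p q)
  ; proper = Q-proper n us (λ zs → proper (G zs))
  ; prime = λ q → Q-prime n us (Q-mono n us (λ zs → prime (G zs)) q) }

record Sig : Set₁ where
  field
    Fun  : Set
    fAr  : Fun → ℕ
    Rel  : Set
    rAr  : Rel → ℕ

open Sig public

record Model (σ : Sig) {c} (C : Set c) (r : Level) : Set (c ⊔ lsuc r) where
  field
    fun : (F : Fun σ) → Vec C (fAr σ F) → C
    rel : (R : Rel σ) → Vec C (rAr σ R) → Set r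

open Model public

IsHom : ∀ {σ c d e r r'} {C : Set c} {D : Set d} (_≈_ : D → D → Set e) →
        Model σ C r → Model σ D r' → (C → D) → Set _
IsHom {σ} _≈_ M N h =
  (∀ (F : Fun σ) xs → h (fun M F xs) ≈ fun N F (map h xs)) ×
  (∀ (R : Rel σ) xs → rel M R xs → rel N R (map h xs))

ftilde : ∀ {X : Set} (n : ℕ) → (Vec X n → X) → Vec (Ultra X) n → Ultra X
ftilde n f us = bind n us (λ zs → principal (f zs))

Rtilde : ∀ {X : Set} (n : ℕ) → (Vec X n → Set) → Vec (Ultra X) n → Set ℓ₁
Rtilde n R us = Q n us (λ zs → Lift ℓ₁ (R zs))

Rstar : ∀ {X : Set} (n : ℕ) → (Vec X n → Set) → Vec (Ultra X) n → Set ℓ₂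
Rstar {X} n R us =
  ∀ (As : Fin n → (X → Set ℓ₁)) → (∀ i → mem (lookup us i) (As i)) →
  Σ (Vec X n) (λ zs → R zs × (∀ i → As i (lookup zs i)))

TildeM : ∀ {σ} {X : Set} → Model σ X lzero → Model σ (Ultra X) ℓ₁
TildeM {σ} A = record
  { fun = λ F → ftilde (fAr σ F) (fun A F)
  ; rel = λ R → Rtilde (rAr σ R) (rel A R) }

StarM : ∀ {σ} {X : Set} → Model σ X lzero → Model σ (Ultra X) ℓ₂
StarM {σ} A = record
  { fun = λ F → ftilde (fAr σ F) (fun A F)
  ; rel = λ R → Rstar (rAr σ R) (rel A R) }

record GenModel (σ : Sig) (X : Set) : Set ℓ₂ where
  field
    funI : (F : Fun σ) → Ultra (Vec X (fAr σ F) → X)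
    relI : (R : Rel σ) → Ultra (Vec X (rAr σ R) → Set)

open GenModel public

-- e on β(Z^{Z^n}): the right-continuous extension, explicitly
-- e(𝔣)(u₁,…,uₙ) = {A : (∀^{u₁} z₁)⋯(∀^{uₙ} zₙ)(∀^𝔣 f) f(z₁,…,zₙ) ∈ A}
eFun : ∀ {X : Set} (n : ℕ) → Ultra (Vec X n → X) → Vec (Ultra X) n → Ultra X
eFun n 𝔣 us = bind n us (λ zs → tilde (λ f → f zs) 𝔣)

eRel : ∀ {X : Set} (n : ℕ) → Ultra (Vec X n → Set) → Vec (Ultra X) n → Set ℓ₁
eRel n 𝔯 us = Q n us (λ zs → mem 𝔯 (λ S → Lift ℓ₁ (S zs)))

eModel : ∀ {σ} {X : Set} → GenModel σ X → Model σ (Ultra X) ℓ₁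
eModel {σ} U = record
  { fun = λ F → eFun (fAr σ F) (funI U F)
  ; rel = λ R → eRel (rAr σ R) (relI U R) }

PseudoPrincipal : ∀ {σ} {X : Set} → GenModel σ X → Set ℓ₂
PseudoPrincipal {σ} {X} U =
  ∀ (F : Fun σ) (as : Vec X (fAr σ F)) →
  Σ X (λ b → tilde (λ f → f as) (funI U F) ≈ᵘ principal b)

GenHom : ∀ {σ} {X Y : Set} → GenModel σ X → GenModel σ Y →
         (Ultra X → Ultra Y) → Set ℓ₂
GenHom U V g = IsHom _≈ᵘ_ (eModel U) (eModel V) g

ModelEq : ∀ {σ} {X : Set} {r r'} → Model σ (Ultra X) r → Model σ (Ultra X) r' →
          Set _
ModelEq {σ} M N =
  (∀ (F : Fun σ) us → fun M F us ≈ᵘ fun N F us) ×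
  (∀ (R : Rel σ) us → rel M R us ⇔ rel N R us)

{-# OPTIONS --safe #-}
module Submission where

open import Defs
open import Level using (Level; 0ℓ; Lift; lift; lower)
open import Data.Nat using (ℕ)
open import Data.Fin using (Fin)
open import Data.Vec using (Vec; []; _∷_; map; lookup)
open import Data.Vec.Properties using (lookup-map)
open import Data.Vec.Relation.Binary.Pointwise.Extensional using (ext; Pointwise-≡⇒≡)
open import Data.Product using (_×_; _,_)
open import Data.Product.Function.NonDependent.Propositional using (_×-⇔_)
open import Function using (_∘_)
open import Function.Bundles using (_⇔_; mk⇔; Equivalence)
import Function.Properties.Equivalence as ⇔
open import Relation.Binary.PropositionalEquality using (_≡_; refl; sym; subst)
open import Relation.Binary.Bundles using (Setoid)
open import Relation.Binary.Structures using (IsEquivalence)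
import Relation.Binary.Reasoning.Setoid as SetoidReasoning

-- Pushing an ultrafilter quantifier forward along h̃ is the same as
-- precomposing the formula with h, and at principal ultrafilters the
-- quantifier is just evaluation.  Hence a condition on h̃ over all of βX
-- specialises, at principal points, to the same condition on h, while
-- conversely the condition on h is carried through the quantifier to every
-- point of βX; for Q* one instantiates the witnessing sets with singletons.
-- Finally (ii) ⇔ (iii) because e(𝔘) = 𝔄̃, e(𝔙) = 𝔅̃ and h̃ respects
-- equality of ultrafilters.

open Equivalence using (to; from)

private
  variable
    a b c d d′ e e′ : Level
    n : ℕ
    X Y : Set

Π-⇔ : {I : Set a} {P : I → Set b} {Q : I → Set c} →
      (∀ i → P i ⇔ Q i) → (∀ i → P i) ⇔ (∀ i → Q i)
Π-⇔ P⇔Q = mk⇔ (λ p i → to (P⇔Q i) (p i)) (λ q i → from (P⇔Q i) (q i))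

≈ᵘ-isEquivalence : IsEquivalence (_≈ᵘ_ {Z = X})
≈ᵘ-isEquivalence = record
  { refl  = λ S → ⇔.refl
  ; sym   = λ u≈v S → ⇔.sym (u≈v S)
  ; trans = λ u≈v v≈w S → ⇔.trans (u≈v S) (v≈w S)
  }

ultrafilterSetoid : Set → Setoid ℓ₂ ℓ₂
ultrafilterSetoid X = record { isEquivalence = ≈ᵘ-isEquivalence {X = X} }

Q-principal : (xs : Vec X n) (φ : Vec X n → Set ℓ₁) → Q n (map principal xs) φ ⇔ φ xs
Q-principal []       φ = ⇔.refl
Q-principal (x ∷ xs) φ = Q-principal xs (φ ∘ (x ∷_))

bind-principal-cong : {Z : Set} {k k′ : Vec X n → Z} → (∀ xs → k xs ≡ k′ xs) →
                      (us : Vec (Ultra X) n) → bind n us (principal ∘ k) ≈ᵘ bind n us (principal ∘ k′)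
bind-principal-cong k≗k′ us S =
  mk⇔ (Q-mono _ us (λ xs → subst S (k≗k′ xs)))
      (Q-mono _ us (λ xs → subst S (sym (k≗k′ xs))))

singleton : X → X → Set ℓ₁
singleton x y = Lift ℓ₁ (y ≡ x)

Rstar-principal : (R : Vec X n → Set) {xs : Vec X n} → R xs → Rstar n R (map principal xs)
Rstar-principal R {xs} r As As∋ =
  xs , r , λ i → subst (λ u → mem u (As i)) (lookup-map i principal xs) (As∋ i)

Rstar-singletons : (S : Vec X n → Set) {us : Vec (Ultra X) n} {xs : Vec X n} →
                   (∀ i → mem (lookup us i) (singleton (lookup xs i))) → Rstar n S us → S xs
Rstar-singletons S {xs = xs} us∋xs s =
  let zs , Szs , zs≡xs = s (singleton ∘ lookup xs) us∋xs
  in subst S (Pointwise-≡⇒≡ (ext (lower ∘ zs≡xs))) Szs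

module _ (h : X → Y) where

  Q-map-tilde : (us : Vec (Ultra X) n) (φ : Vec Y n → Set ℓ₁) →
                Q n (map (tilde h) us) φ ⇔ Q n us (φ ∘ map h)
  Q-map-tilde []       φ = ⇔.refl
  Q-map-tilde (u ∷ us) φ = mk⇔
    (mono u (λ x → to   (Q-map-tilde us (φ ∘ (h x ∷_)))))
    (mono u (λ x → from (Q-map-tilde us (φ ∘ (h x ∷_)))))

  Q-map-tilde-principal : (xs : Vec X n) (φ : Vec Y n → Set ℓ₁) →
                          Q n (map (tilde h) (map principal xs)) φ ⇔ φ (map h xs)
  Q-map-tilde-principal xs φ =
    ⇔.trans (Q-map-tilde (map principal xs) φ) (Q-principal xs (φ ∘ map h))

  ftilde-map-tilde : (g : Vec Y n → Y) (us : Vec (Ultra X) n) →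
                     ftilde n g (map (tilde h) us) ≈ᵘ bind n us (principal ∘ g ∘ map h)
  ftilde-map-tilde g us S = Q-map-tilde us (S ∘ g)

  ftilde-commutes⇔ : (f : Vec X n → X) (g : Vec Y n → Y) →
    (∀ xs → h (f xs) ≡ g (map h xs)) ⇔
    (∀ us → tilde h (ftilde n f us) ≈ᵘ ftilde n g (map (tilde h) us))
  ftilde-commutes⇔ {n} f g = mk⇔
    (λ commutes us → begin
      tilde h (ftilde n f us)             ≈⟨ bind-principal-cong {k = h ∘ f} commutes us ⟩
      bind n us (principal ∘ g ∘ map h)   ≈⟨ ftilde-map-tilde g us ⟨
      ftilde n g (map (tilde h) us)       ∎)
    (λ commutes xs →
      let S : Y → Set ℓ₁
          S y = Lift ℓ₁ (h (f xs) ≡ y)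
      in lower (to (Q-map-tilde-principal xs (S ∘ g))
                   (to (commutes (map principal xs) S)
                       (from (Q-principal xs (S ∘ h ∘ f)) (lift refl)))))
    where open SetoidReasoning (ultrafilterSetoid Y)

  Rtilde-preserved⇔ : (R : Vec X n → Set) (S : Vec Y n → Set) →
    (∀ xs → R xs → S (map h xs)) ⇔
    (∀ us → Rtilde n R us → Rtilde n S (map (tilde h) us))
  Rtilde-preserved⇔ R S = mk⇔
    (λ preserves us r →
      from (Q-map-tilde us (Lift ℓ₁ ∘ S)) (Q-mono _ us (λ xs → lift ∘ preserves xs ∘ lower) r))
    (λ preserves xs r →
      lower (to (Q-map-tilde-principal xs (Lift ℓ₁ ∘ S))
                (preserves (map principal xs) (from (Q-principal xs (Lift ℓ₁ ∘ R)) (lift r)))))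

  map-tilde-principal∋ : (xs : Vec X n) (i : Fin n) →
    mem (lookup (map (tilde h) (map principal xs)) i) (singleton (lookup (map h xs) i))
  map-tilde-principal∋ xs i
    rewrite lookup-map i (tilde h) (map principal xs)
          | lookup-map i principal xs
          | lookup-map i h xs
          = lift refl

  Rstar-map-tilde : {R : Vec X n → Set} {S : Vec Y n → Set} → (∀ xs → R xs → S (map h xs)) →
                    (us : Vec (Ultra X) n) → Rstar n R us → Rstar n S (map (tilde h) us)
  Rstar-map-tilde preserves us r As As∋
    with r (λ i → As i ∘ h) (λ i → subst (λ u → mem u (As i)) (lookup-map i (tilde h) us) (As∋ i))
  ... | zs , Rzs , zs∈As =
    map h zs , preserves zs Rzs , λ i → subst (As i) (sym (lookup-map i h zs)) (zs∈As i)

  Rstar-preserved⇔ : (R : Vec X n → Set) (S : Vec Y n → Set) →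
    (∀ xs → R xs → S (map h xs)) ⇔
    (∀ us → Rstar n R us → Rstar n S (map (tilde h) us))
  Rstar-preserved⇔ R S = mk⇔ Rstar-map-tilde
    (λ preserves xs r →
      Rstar-singletons S {us = map (tilde h) (map principal xs)} (map-tilde-principal∋ xs)
        (preserves (map principal xs) (Rstar-principal R r)))

module _ {σ : Sig} (A : Model σ X 0ℓ) (B : Model σ Y 0ℓ) (h : X → Y) where

  IsHom⇔IsHom-TildeM : IsHom _≡_ A B h ⇔ IsHom _≈ᵘ_ (TildeM A) (TildeM B) (tilde h)
  IsHom⇔IsHom-TildeM =
    Π-⇔ (λ F → ftilde-commutes⇔ h (fun A F) (fun B F)) ×-⇔
    Π-⇔ (λ R → Rtilde-preserved⇔ h (rel A R) (rel B R))

  IsHom⇔IsHom-StarM : IsHom _≡_ A B h ⇔ IsHom _≈ᵘ_ (StarM A) (StarM B) (tilde h)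
  IsHom⇔IsHom-StarM =
    Π-⇔ (λ F → ftilde-commutes⇔ h (fun A F) (fun B F)) ×-⇔
    Π-⇔ (λ R → Rstar-preserved⇔ h (rel A R) (rel B R))

ModelEq-sym : {σ : Sig} {M : Model σ (Ultra X) d} {M′ : Model σ (Ultra X) d′} →
              ModelEq M M′ → ModelEq M′ M
ModelEq-sym (fun-eq , rel-eq) =
  (λ F us S → ⇔.sym (fun-eq F us S)) , (λ R us → ⇔.sym (rel-eq R us))

module _ {σ : Sig} {M : Model σ (Ultra X) d} {M′ : Model σ (Ultra X) d′}
         {N : Model σ (Ultra Y) e} {N′ : Model σ (Ultra Y) e′} where

  IsHom-resp-ModelEq : (h : X → Y) → ModelEq M′ M → ModelEq N N′ →
                       IsHom _≈ᵘ_ M N (tilde h) → IsHom _≈ᵘ_ M′ N′ (tilde h)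
  IsHom-resp-ModelEq h (M′≈M-fun , M′≈M-rel) (N≈N′-fun , N≈N′-rel) (h-fun , h-rel) =
    (λ F us → begin
      tilde h (fun M′ F us)        ≈⟨ (λ S → M′≈M-fun F us (S ∘ h)) ⟩
      tilde h (fun M F us)         ≈⟨ h-fun F us ⟩
      fun N F (map (tilde h) us)   ≈⟨ N≈N′-fun F (map (tilde h) us) ⟩
      fun N′ F (map (tilde h) us)  ∎) ,
    (λ R us → to (N≈N′-rel R (map (tilde h) us)) ∘ h-rel R us ∘ to (M′≈M-rel R us))
    where open SetoidReasoning (ultrafilterSetoid Y)

module _ {σ : Sig} {M : Model σ (Ultra X) d} {M′ : Model σ (Ultra X) d′}
         {N : Model σ (Ultra Y) e} {N′ : Model σ (Ultra Y) e′} where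

  IsHom⇔IsHom-ModelEq : (h : X → Y) → ModelEq M M′ → ModelEq N N′ →
                        IsHom _≈ᵘ_ M N (tilde h) ⇔ IsHom _≈ᵘ_ M′ N′ (tilde h)
  IsHom⇔IsHom-ModelEq h M≈M′ N≈N′ =
    mk⇔ (IsHom-resp-ModelEq {M = M} {M′} {N} {N′} h (ModelEq-sym {M = M} {M′} M≈M′) N≈N′)
        (IsHom-resp-ModelEq {M = M′} {M} {N′} {N} h M≈M′ (ModelEq-sym {M = N} {N′} N≈N′))

theorem32 : {σ : Sig} {X Y : Set} (U : GenModel σ X) (V : GenModel σ Y) →
    PseudoPrincipal U → PseudoPrincipal V →
    (A : Model σ X 0ℓ) (B : Model σ Y 0ℓ) →
    ModelEq (TildeM A) (eModel U) → ModelEq (TildeM B) (eModel V) →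
    (h : X → Y) →
    (IsHom _≡_ A B h ⇔ GenHom U V (tilde h)) ×
    (GenHom U V (tilde h) ⇔ IsHom _≈ᵘ_ (TildeM A) (TildeM B) (tilde h)) ×
    (IsHom _≈ᵘ_ (TildeM A) (TildeM B) (tilde h) ⇔ IsHom _≈ᵘ_ (StarM A) (StarM B) (tilde h))
theorem32 U V _ _ A B 𝔄̃≈e𝔘 𝔅̃≈e𝔙 h =
  ⇔.trans (IsHom⇔IsHom-TildeM A B h) iii⇔ii ,
  ⇔.sym iii⇔ii ,
  ⇔.trans (⇔.sym (IsHom⇔IsHom-TildeM A B h)) (IsHom⇔IsHom-StarM A B h)
  where
    iii⇔ii : IsHom _≈ᵘ_ (TildeM A) (TildeM B) (tilde h) ⇔ GenHom U V (tilde h)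
    iii⇔ii = IsHom⇔IsHom-ModelEq {M = TildeM A} {eModel U} {TildeM B} {eModel V} h 𝔄̃≈e𝔘 𝔅̃≈e𝔙
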